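{- Let $n,k$ be integers with $k\ge1$, $n>2k$. For every minimum vertex cover $c^*$ of the generalized Petersen graph $P(n,k)$ we have $a(c^*)-b(c^*)=d(P(n,k))$.
   Context: $P(n,k)$ has vertex set $U\cup V$, $U=\{u_1,\dots,u_n\}$, $V=\{v_1,\dots,v_n\}$, edges $u_iu_{i+1}$, $u_iv_i$, $v_iv_{i+k}$ (subscripts modulo $n$). A cover is non-trivial if it does not contain all of $V$; $\mathcal{C}(P(n,k))$ is the set of non-trivial vertex covers. For a non-trivial cover $c$, a strip is a maximal set of circularly consecutive vertices $\{v_i,v_{i+1},\dots,v_{i+m}\}$ of $V$ all in $c$; a strip is odd if it has an odd number of vertices. $a(c)=|c\cap V|$, $b(c)$ is the number of odd strips of $c$, and $d(P(n,k))=\min_{c\in\mathcal{C}(P(n,k))}(a(c)-b(c))$. (Minimum vertex covers are non-trivial.) -}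

module Defs where

open import Data.Nat using (ℕ; zero; suc; _+_; _≤_; _<_; _*_)
open import Data.Nat.DivMod using (_%_; m%n<n)
open import Data.Fin using (Fin; toℕ; fromℕ<)
open import Data.Bool using (Bool; true; false; T; _∧_; _∨_; not; if_then_else_)
open import Data.List using (List; map; allFin)
open import Data.Nat.ListAction using (sum)
open import Data.Integer using (ℤ; +_; _-_)
import Data.Integer
open import Data.Product using (_×_; ∃)
open import Data.Empty using (⊥)
open import Relation.Binary.PropositionalEquality using (_≡_)

_⊕_ : ∀ {n} → Fin n → ℕ → Fin n
_⊕_ {suc m} i j = fromℕ< (m%n<n (toℕ i + j) (suc m))

-- i - 1 modulo n
prev : ∀ {n} → Fin n → Fin n
prev {suc m} i = i ⊕ m

count : ∀ {n} → (Fin n → Bool) → ℕ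
count {n} f = sum (map (λ i → if f i then 1 else 0) (allFin n))

-- a subset of V(P(n,k)) = U ∪ V, given by membership of u_i and of v_i
record Cover (n : ℕ) : Set where
  constructor mkCover
  field
    inU : Fin n → Bool
    inV : Fin n → Bool
open Cover public

-- vertex cover of P(n,k): edges u_i u_{i+1}, u_i v_i, v_i v_{i+k}
IsVertexCover : (n k : ℕ) → Cover n → Set
IsVertexCover n k c = ∀ (i : Fin n) →
  T (inU c i ∨ inU c (i ⊕ 1)) × T (inU c i ∨ inV c i) × T (inV c i ∨ inV c (i ⊕ k))

size : ∀ {n} → Cover n → ℕ
size c = count (inU c) + count (inV c)

IsMinimumVertexCover : (n k : ℕ) → Cover n → Set
IsMinimumVertexCover n k c =
  IsVertexCover n k c × (∀ (c′ : Cover n) → IsVertexCover n k c′ → size c ≤ size c′)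

NonTrivial : ∀ {n} → Cover n → Set
NonTrivial {n} c = ∃ λ (i : Fin n) → inV c i ≡ false

-- length of the run of consecutive members of V starting at v_i (fuel-bounded by n;
-- for a non-trivial cover the run has length < n, so fuel n suffices)
runLen : ∀ {n} → (Fin n → Bool) → Fin n → ℕ → ℕ
runLen f i zero = 0
runLen f i (suc t) = if f i then suc (runLen f (i ⊕ 1) t) else 0

startsStrip : ∀ {n} → (Fin n → Bool) → Fin n → Bool
startsStrip f i = f i ∧ not (f (prev i))

isOddℕ : ℕ → Bool
isOddℕ zero = false
isOddℕ (suc m) = not (isOddℕ m)

aC : ∀ {n} → Cover n → ℕ
aC c = count (inV c)

-- b(c) = number of odd strips (each strip counted once, at its first vertex)
bC : ∀ {n} → Cover n → ℕ
bC {n} c = count (λ i → startsStrip (inV c) i ∧ isOddℕ (runLen (inV c) i n))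

abC : ∀ {n} → Cover n → ℤ
abC c = + aC c - + bC c

-- "a(c) - b(c) = d(P(n,k))": c is a non-trivial vertex cover attaining the
-- minimum of a - b over all non-trivial vertex covers
AttainsD : (n k : ℕ) → Cover n → Set
AttainsD n k c =
  IsVertexCover n k c × NonTrivial c ×
  (∀ (c′ : Cover n) → IsVertexCover n k c′ → NonTrivial c′ →
     Data.Integer._≤_ (abC c) (abC c′))

module Submission where

-- Fix a set f ⊆ V missing some v_j and let p(i) be the parity of the
-- run of consecutive V-vertices of f starting at v_i.  Give position i of the cycle
-- the weight  w(i) = 2[u_i] + [v_i] + [v_i starts an odd strip]  and the potential
-- ψ(i) = 2  if p(i) is even,  2[u_i ∉ c] + [v_i does not start an odd strip]  if odd.
-- A short case analysis shows  w(i) + ψ(i) ≥ 2 + ψ(i+1)  for every vertex cover,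
-- with equality when u_i is chosen exactly at the even runs.  Summing around the
-- cycle, the potential telescopes away, so
--     2|c ∩ U| + a(c) + b(c) ≥ 2n          for every non-trivial vertex cover c,
-- and every non-trivial V-part extends to a vertex cover attaining equality.
-- For a minimum cover c and a non-trivial cover c′, compare c with the optimal
-- completion c″ of c′ ∩ V: |c| ≤ |c″| and the two bounds give a(c) - b(c) ≤ a(c′) - b(c′).
-- Minimum covers are non-trivial by the same comparison with the completion of
-- {v_1, …, v_{n-1}}.

open import Defs
open import Data.Nat using (ℕ; zero; suc; _+_; _*_; _≤_; _<_; z≤n; s≤s; s≤s⁻¹)
open import Data.Nat.Properties
open import Data.Nat.DivMod using (_%_; m%n<n; %-distribˡ-+; m%n%n≡m%n; [m+n]%n≡m%n; m<n⇒m%n≡m)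
open import Data.Nat.Solver using (module +-*-Solver)
open import Data.Fin using (Fin; toℕ; zero; suc)
open import Data.Fin.Properties using (fromℕ<-cong; fromℕ<-toℕ; toℕ-fromℕ<; toℕ<n; all?; ¬∀⟶∃¬)
open import Data.Bool using (Bool; true; false; T; _∧_; _∨_; not; if_then_else_)
open import Data.Bool.Properties using (not-involutive; ∧-zeroʳ; ¬-not) renaming (_≟_ to _≟ᵇ_)
open import Data.List using (tabulate)
open import Data.List.Properties using (map-tabulate)
open import Data.Nat.ListAction using (sum)
open import Data.Product using (∃; _×_; _,_; proj₁; proj₂)
open import Data.Unit using (tt)
open import Data.Empty using (⊥; ⊥-elim)
open import Data.Integer using (_⊖_) renaming (+_ to ⁺_; _≤_ to _≤ℤ_; _-_ to _-ℤ_)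
import Data.Integer.Properties as ℤ
open import Relation.Nullary using (yes; no)
open import Relation.Binary.PropositionalEquality hiding ([_])

open +-*-Solver using (solve; _:+_; _:*_; _:=_; con)

[_] : Bool → ℕ
[ b ] = if b then 1 else 0

sumFrom : (ℕ → ℕ) → ℕ → ℕ → ℕ
sumFrom H j zero = 0
sumFrom H j (suc L) = H j + sumFrom H (suc j) L

Periodic : ℕ → (ℕ → ℕ) → Set
Periodic L H = ∀ x → H (x + L) ≡ H x

sumFrom-+ : ∀ (G H : ℕ → ℕ) j L → sumFrom (λ x → G x + H x) j L ≡ sumFrom G j L + sumFrom H j L
sumFrom-+ G H j zero = refl
sumFrom-+ G H j (suc L) rewrite sumFrom-+ G H (suc j) L =
  solve 4 (λ a b A B → (a :+ b) :+ (A :+ B) := (a :+ A) :+ (b :+ B)) refl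
    (G j) (H j) (sumFrom G (suc j) L) (sumFrom H (suc j) L)

sumFrom-scale : ∀ c (H : ℕ → ℕ) j L → sumFrom (λ x → c * H x) j L ≡ c * sumFrom H j L
sumFrom-scale c H j zero = sym (*-zeroʳ c)
sumFrom-scale c H j (suc L) =
  trans (cong (c * H j +_) (sumFrom-scale c H (suc j) L)) (sym (*-distribˡ-+ c (H j) _))

sumFrom-const : ∀ c j L → sumFrom (λ _ → c) j L ≡ L * c
sumFrom-const c j zero = refl
sumFrom-const c j (suc L) = cong (c +_) (sumFrom-const c (suc j) L)

sumFrom-mono : ∀ {G H : ℕ → ℕ} → (∀ x → G x ≤ H x) → ∀ j L → sumFrom G j L ≤ sumFrom H j L
sumFrom-mono G≤H j zero = z≤n
sumFrom-mono G≤H j (suc L) = +-mono-≤ (G≤H j) (sumFrom-mono G≤H (suc j) L)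

sumFrom-cong : ∀ {G H : ℕ → ℕ} → (∀ x → G x ≡ H x) → ∀ j L → sumFrom G j L ≡ sumFrom H j L
sumFrom-cong G≡H j zero = refl
sumFrom-cong G≡H j (suc L) = cong₂ _+_ (G≡H j) (sumFrom-cong G≡H (suc j) L)

sumFrom-snoc : ∀ H j L → sumFrom H j (suc L) ≡ sumFrom H j L + H (j + L)
sumFrom-snoc H j zero = trans (+-identityʳ (H j)) (cong H (sym (+-identityʳ j)))
sumFrom-snoc H j (suc L) = begin
  H j + sumFrom H (suc j) (suc L)          ≡⟨ cong (H j +_) (sumFrom-snoc H (suc j) L) ⟩
  H j + (sumFrom H (suc j) L + H (suc j + L)) ≡⟨ sym (+-assoc (H j) _ _) ⟩
  H j + sumFrom H (suc j) L + H (suc j + L)   ≡⟨ cong (λ y → H j + sumFrom H (suc j) L + H y) (sym (+-suc j L)) ⟩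
  H j + sumFrom H (suc j) L + H (j + suc L)   ∎
  where open ≡-Reasoning

sumFrom-∘suc : ∀ H j L → sumFrom (λ x → H (suc x)) j L ≡ sumFrom H (suc j) L
sumFrom-∘suc H j zero = refl
sumFrom-∘suc H j (suc L) = cong (H (suc j) +_) (sumFrom-∘suc H (suc j) L)

sumFrom-rotate : ∀ {L} H → Periodic L H → sumFrom (λ x → H (suc x)) 0 L ≡ sumFrom H 0 L
sumFrom-rotate {L} H per = +-cancelʳ-≡ (H 0) _ _ (begin
  sumFrom (λ x → H (suc x)) 0 L + H 0 ≡⟨ cong (_+ H 0) (sumFrom-∘suc H 0 L) ⟩
  sumFrom H 1 L + H 0                 ≡⟨ +-comm _ (H 0) ⟩
  sumFrom H 0 (suc L)                 ≡⟨ sumFrom-snoc H 0 L ⟩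
  sumFrom H 0 L + H L                 ≡⟨ cong (sumFrom H 0 L +_) (per 0) ⟩
  sumFrom H 0 L + H 0                 ∎)
  where open ≡-Reasoning

-- Telescoping along a cycle: the differences of a periodic potential ψ sum to zero.
telescope : ∀ {L} B ψ → Periodic L ψ →
  sumFrom (λ x → B + ψ (suc x)) 0 L ≡ L * B + sumFrom ψ 0 L
telescope {L} B ψ per = begin
  sumFrom (λ x → B + ψ (suc x)) 0 L              ≡⟨ sumFrom-+ (λ _ → B) (λ x → ψ (suc x)) 0 L ⟩
  sumFrom (λ _ → B) 0 L + sumFrom (λ x → ψ (suc x)) 0 L ≡⟨ cong₂ _+_ (sumFrom-const B 0 L) (sumFrom-rotate ψ per) ⟩
  L * B + sumFrom ψ 0 L                          ∎
  where open ≡-Reasoning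

potential-lower : ∀ {L} B H ψ → Periodic L ψ → (∀ x → B + ψ (suc x) ≤ H x + ψ x) →
  L * B ≤ sumFrom H 0 L
potential-lower {L} B H ψ per step = +-cancelʳ-≤ (sumFrom ψ 0 L) _ _ (begin
  L * B + sumFrom ψ 0 L             ≡⟨ telescope B ψ per ⟨
  sumFrom (λ x → B + ψ (suc x)) 0 L ≤⟨ sumFrom-mono step 0 L ⟩
  sumFrom (λ x → H x + ψ x) 0 L     ≡⟨ sumFrom-+ H ψ 0 L ⟩
  sumFrom H 0 L + sumFrom ψ 0 L     ∎)
  where open ≤-Reasoning

potential-exact : ∀ {L} B H ψ → Periodic L ψ → (∀ x → H x + ψ x ≡ B + ψ (suc x)) →
  sumFrom H 0 L ≡ L * B
potential-exact {L} B H ψ per step = +-cancelʳ-≡ (sumFrom ψ 0 L) _ _ (begin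
  sumFrom H 0 L + sumFrom ψ 0 L     ≡⟨ sumFrom-+ H ψ 0 L ⟨
  sumFrom (λ x → H x + ψ x) 0 L     ≡⟨ sumFrom-cong step 0 L ⟩
  sumFrom (λ x → B + ψ (suc x)) 0 L ≡⟨ telescope B ψ per ⟩
  L * B + sumFrom ψ 0 L             ∎)
  where open ≡-Reasoning

-- Local data at one position of the cycle: membership g of u_i, f of v_i, and
-- s = "v_i begins an odd strip".  The weight is the contribution of position i to
-- 2|c ∩ U| + a(c) + b(c); the potential depends on the parity p of the run of V
-- starting at v_i.
weight : Bool → Bool → Bool → ℕ
weight g f s = 2 * [ g ] + [ f ] + [ s ]

potential : Bool → Bool → Bool → ℕ
potential g true  s = 2 * [ not g ] + [ not s ]
potential g false s = 2

-- How the parity of the run starting at v_i changes from i to i+1: outside V the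
-- run is empty (even); inside V it is one longer than the run starting at v_{i+1}.
data RunStep : Bool → Bool → Bool → Set where
  gap    : ∀ {p′} → RunStep false false p′
  inside : ∀ p → RunStep true p (not p)

odd-balance : ∀ g s → weight g true s + potential g true s ≡ 4
odd-balance true  true  = refl
odd-balance true  false = refl
odd-balance false true  = refl
odd-balance false false = refl

-- at the first vertex of a strip (s = p) the potential is at most 2
potential-start : ∀ g p → potential g p p ≤ 2
potential-start true  true  = z≤n
potential-start false true  = ≤-refl
potential-start g     false = ≤-refl

-- Local inequality for an arbitrary vertex cover: uses the edges u_i u_{i+1}
-- and u_i v_i; s₀ = a ∧ p₀ and s₁ = (f₁ ∧ ¬f₀) ∧ p₁ are the odd-strip indicators.
local-lower : ∀ {f₀ p₀ p₁ f₁ p₂} g₀ g₁ a → RunStep f₀ p₀ p₁ → RunStep f₁ p₁ p₂ →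
  T (g₀ ∨ g₁) → T (g₀ ∨ f₀) →
  2 + potential g₁ p₁ ((f₁ ∧ not f₀) ∧ p₁) ≤ weight g₀ f₀ (a ∧ p₀) + potential g₀ p₀ (a ∧ p₀)
local-lower true  g₁ a gap gap _ _ rewrite ∧-zeroʳ a = ≤-refl
local-lower true  g₁ a gap (inside p₁) _ _ rewrite ∧-zeroʳ a = +-monoʳ-≤ 2 (potential-start g₁ p₁)
local-lower g₀ g₁ a (inside true) _ _ _ = ≤-reflexive (sym (odd-balance g₀ (a ∧ true)))
local-lower true  true  a (inside false) (inside true) _ _ rewrite ∧-zeroʳ a = m≤n+m 3 2
local-lower true  false a (inside false) (inside true) _ _ rewrite ∧-zeroʳ a = ≤-refl
local-lower false true  a (inside false) (inside true) _ _ rewrite ∧-zeroʳ a = ≤-refl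

local-exact : ∀ {f₀ p₀ p₁ f₁ p₂} a → RunStep f₀ p₀ p₁ → RunStep f₁ p₁ p₂ →
  weight (not p₀) f₀ (a ∧ p₀) + potential (not p₀) p₀ (a ∧ p₀)
    ≡ 2 + potential (not p₁) p₁ ((f₁ ∧ not f₀) ∧ p₁)
local-exact a gap gap rewrite ∧-zeroʳ a = refl
local-exact a gap (inside true) rewrite ∧-zeroʳ a = refl
local-exact a gap (inside false) rewrite ∧-zeroʳ a = refl
local-exact a (inside true) _ = odd-balance false (a ∧ true)
local-exact a (inside false) (inside true) rewrite ∧-zeroʳ a = refl

even-covers-cycle : ∀ {f p p′} → RunStep f p p′ → T (not p ∨ not p′)
even-covers-cycle gap = tt
even-covers-cycle (inside true) = tt
even-covers-cycle (inside false) = tt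

even-covers-spokes : ∀ {f p p′} → RunStep f p p′ → T (not p ∨ f)
even-covers-spokes gap = tt
even-covers-spokes (inside true) = tt
even-covers-spokes (inside false) = tt

-- a U-set covering the cycle u_0 … u_{n-1}: local inequality with potential [¬g]
cycle-step : ∀ g g′ → T (g ∨ g′) → 1 + [ not g′ ] ≤ 2 * [ g ] + [ not g ]
cycle-step true  true  _ = s≤s z≤n
cycle-step true  false _ = s≤s (s≤s z≤n)
cycle-step false true  _ = ≤-refl

-- Positions of the n-cycle (n = suc m) indexed by ℕ, reduced modulo n.
module Cyclic (m : ℕ) where
  n : ℕ
  n = suc m

  idx : ℕ → Fin n
  idx s = zero ⊕ s

  idx-⊕ : ∀ s a → idx s ⊕ a ≡ idx (s + a)
  idx-⊕ s a = fromℕ<-cong _ _ (begin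
    (toℕ (idx s) + a) % n       ≡⟨ cong (λ z → (z + a) % n) (toℕ-fromℕ< (m%n<n s n)) ⟩
    (s % n + a) % n             ≡⟨ %-distribˡ-+ (s % n) a n ⟩
    (s % n % n + a % n) % n     ≡⟨ cong (λ z → (z + a % n) % n) (m%n%n≡m%n s n) ⟩
    (s % n + a % n) % n         ≡⟨ %-distribˡ-+ s a n ⟨
    (s + a) % n                 ∎) _ _
    where open ≡-Reasoning

  idx-suc : ∀ s → idx s ⊕ 1 ≡ idx (suc s)
  idx-suc s = trans (idx-⊕ s 1) (cong idx (+-comm s 1))

  idx-periodic : ∀ s → idx (s + n) ≡ idx s
  idx-periodic s = fromℕ<-cong _ _ ([m+n]%n≡m%n s n) _ _

  idx-toℕ : ∀ (i : Fin n) → idx (toℕ i) ≡ i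
  idx-toℕ i = trans (fromℕ<-cong _ _ (m<n⇒m%n≡m (toℕ<n i)) _ (toℕ<n i)) (fromℕ<-toℕ i _)

  prev-idx : ∀ s → prev (idx (suc s)) ≡ idx s
  prev-idx s = trans (idx-⊕ (suc s) m) (trans (cong idx (sym (+-suc s m))) (idx-periodic s))

  periodic : (h : Fin n → ℕ) → Periodic n (λ x → h (idx x))
  periodic h x = cong h (idx-periodic x)

  count-sumFrom : (h : Fin n → Bool) → count h ≡ sumFrom (λ x → [ h (idx x) ]) 0 n
  count-sumFrom h = trans (cong sum (map-tabulate (λ i → i) (λ i → [ h i ])))
                          (tabulate-sum n (λ i → [ h i ]) (λ x → [ h (idx x) ]) (λ i → cong (λ z → [ h z ]) (sym (idx-toℕ i))))
    where
    tabulate-sum : ∀ L (g : Fin L → ℕ) (H : ℕ → ℕ) → (∀ i → g i ≡ H (toℕ i)) → sum (tabulate g) ≡ sumFrom H 0 L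
    tabulate-sum zero g H g≡H = refl
    tabulate-sum (suc L) g H g≡H = cong₂ _+_ (g≡H zero)
      (trans (tabulate-sum L (λ i → g (suc i)) (λ x → H (suc x)) (λ i → g≡H (suc i))) (sumFrom-∘suc H 0 L))

module Strips (m : ℕ) (f : Fin (suc m) → Bool) (j : Fin (suc m)) (fj : f j ≡ false) where
  open Cyclic m

  parity : Fin n → Bool
  parity i = isOddℕ (runLen f i n)

  oddStrip : Fin n → Bool
  oddStrip i = startsStrip f i ∧ parity i

  run : ℕ → ℕ → ℕ
  run s t = runLen f (idx s) t

  run-unfold : ∀ s t → run s (suc t) ≡ (if f (idx s) then suc (run (suc s) t) else 0)
  run-unfold s t = cong (λ i → if f (idx s) then suc (runLen f i t) else 0) (idx-suc s)

  run-outside : ∀ {s} → f (idx s) ≡ false → ∀ t → run s t ≡ 0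
  run-outside e zero = refl
  run-outside {s} e (suc t) = trans (run-unfold s t) (cong (λ b → if b then suc (run (suc s) t) else 0) e)

  window : ∀ t → ∃ λ d → d ≤ m × f (idx (t + d)) ≡ false
  window zero = toℕ j , s≤s⁻¹ (toℕ<n j) , trans (cong f (idx-toℕ j)) fj
  window (suc t) with window t
  ... | suc d , d<m , e = d , ≤-trans (n≤1+n d) d<m , trans (cong (λ y → f (idx y)) (sym (+-suc t d))) e
  ... | zero  , _   , e = m , ≤-refl , trans (cong f (trans (cong idx (sym (+-suc t m))) (idx-periodic t)))
                                            (trans (cong (λ y → f (idx y)) (sym (+-identityʳ t))) e)

  fuel-irrelevant : ∀ d s t t′ → f (idx (s + d)) ≡ false → d ≤ t → d ≤ t′ → run s t ≡ run s t′
  fuel-irrelevant zero s t t′ e _ _ = trans (run-outside {s} e′ t) (sym (run-outside {s} e′ t′))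
    where
    e′ : f (idx s) ≡ false
    e′ = trans (cong (λ y → f (idx y)) (sym (+-identityʳ s))) e
  fuel-irrelevant (suc d) s (suc t) (suc t′) e (s≤s d≤t) (s≤s d≤t′) = begin
    run s (suc t)                                  ≡⟨ run-unfold s t ⟩
    (if f (idx s) then suc (run (suc s) t) else 0)  ≡⟨ cong (λ r → if f (idx s) then suc r else 0) IH ⟩
    (if f (idx s) then suc (run (suc s) t′) else 0) ≡⟨ run-unfold s t′ ⟨
    run s (suc t′)                                 ∎
    where
    open ≡-Reasoning
    IH : run (suc s) t ≡ run (suc s) t′
    IH = fuel-irrelevant d (suc s) t t′ (trans (cong (λ y → f (idx y)) (sym (+-suc s d))) e) d≤t d≤t′

  runStep : ∀ x → RunStep (f (idx x)) (parity (idx x)) (parity (idx (suc x)))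
  runStep x = step (f (idx x)) refl
    where
    step : ∀ b → f (idx x) ≡ b → RunStep b (parity (idx x)) (parity (idx (suc x)))
    step false e = subst (λ p → RunStep false p (parity (idx (suc x)))) (sym even) gap
      where
      even : parity (idx x) ≡ false
      even = cong isOddℕ (run-outside {x} e n)
    step true e = subst (RunStep true (parity (idx x))) flip (inside (parity (idx x)))
      where
      longer : run x n ≡ suc (run (suc x) n)
      longer with window (suc x)
      ... | d , d≤m , e′ = trans (trans (run-unfold x m) (cong (λ b → if b then suc (run (suc x) m) else 0) e))
                                 (cong suc (fuel-irrelevant d (suc x) m n e′ d≤m (m≤n⇒m≤1+n d≤m)))
      flip : not (parity (idx x)) ≡ parity (idx (suc x))
      flip = trans (cong (λ r → not (isOddℕ r)) longer) (not-involutive _)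

  -- the predecessor of position x+1 is x
  oddStrip-next : ∀ x → oddStrip (idx (suc x)) ≡ (f (idx (suc x)) ∧ not (f (idx x))) ∧ parity (idx (suc x))
  oddStrip-next x = cong (λ i → (f (idx (suc x)) ∧ not (f i)) ∧ parity (idx (suc x))) (prev-idx x)

  weightAt : (Fin n → Bool) → ℕ → ℕ
  weightAt g x = weight (g (idx x)) (f (idx x)) (oddStrip (idx x))

  potentialAt : (Fin n → Bool) → ℕ → ℕ
  potentialAt g x = potential (g (idx x)) (parity (idx x)) (oddStrip (idx x))

  weighted-count : ∀ g → 2 * count g + count f + count oddStrip ≡ sumFrom (weightAt g) 0 n
  weighted-count g = begin
    2 * count g + count f + count oddStrip
      ≡⟨ cong₂ (λ a b → 2 * a + b + count oddStrip) (count-sumFrom g) (count-sumFrom f) ⟩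
    2 * sumFrom [g] 0 n + sumFrom [f] 0 n + count oddStrip
      ≡⟨ cong₂ (λ a b → a + sumFrom [f] 0 n + b) (sym (sumFrom-scale 2 [g] 0 n)) (count-sumFrom oddStrip) ⟩
    sumFrom (λ x → 2 * [g] x) 0 n + sumFrom [f] 0 n + sumFrom [s] 0 n
      ≡⟨ cong (_+ sumFrom [s] 0 n) (sumFrom-+ (λ x → 2 * [g] x) [f] 0 n) ⟨
    sumFrom (λ x → 2 * [g] x + [f] x) 0 n + sumFrom [s] 0 n
      ≡⟨ sumFrom-+ (λ x → 2 * [g] x + [f] x) [s] 0 n ⟨
    sumFrom (weightAt g) 0 n ∎
    where
    open ≡-Reasoning
    [g] [f] [s] : ℕ → ℕ
    [g] x = [ g (idx x) ]
    [f] x = [ f (idx x) ]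
    [s] x = [ oddStrip (idx x) ]

  potentialAt-next : ∀ g x → potentialAt g (suc x)
    ≡ potential (g (idx (suc x))) (parity (idx (suc x))) ((f (idx (suc x)) ∧ not (f (idx x))) ∧ parity (idx (suc x)))
  potentialAt-next g x = cong (potential (g (idx (suc x))) (parity (idx (suc x)))) (oddStrip-next x)

  lower-bound : (g : Fin n → Bool) → (∀ x → T (g (idx x) ∨ g (idx (suc x)))) → (∀ i → T (g i ∨ f i)) →
    2 * n ≤ 2 * count g + count f + count oddStrip
  lower-bound g cycle spokes = subst₂ _≤_ (*-comm n 2) (sym (weighted-count g))
    (potential-lower 2 (weightAt g) (potentialAt g) (periodic (λ i → potential (g i) (parity i) (oddStrip i))) step)
    where
    step : ∀ x → 2 + potentialAt g (suc x) ≤ weightAt g x + potentialAt g x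
    step x = subst (λ ψ → 2 + ψ ≤ weightAt g x + potentialAt g x) (sym (potentialAt-next g x))
      (local-lower (g (idx x)) (g (idx (suc x))) (startsStrip f (idx x)) (runStep x) (runStep (suc x))
                   (cycle x) (spokes (idx x)))

  evenRuns : Fin n → Bool
  evenRuns i = not (parity i)

  evenRuns-cycle : ∀ x → T (evenRuns (idx x) ∨ evenRuns (idx (suc x)))
  evenRuns-cycle x = even-covers-cycle (runStep x)

  evenRuns-spokes : ∀ x → T (evenRuns (idx x) ∨ f (idx x))
  evenRuns-spokes x = even-covers-spokes (runStep x)

  evenRuns-exact : 2 * count evenRuns + count f + count oddStrip ≡ 2 * n
  evenRuns-exact = trans (weighted-count evenRuns)
    (trans (potential-exact 2 (weightAt evenRuns) (potentialAt evenRuns)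
             (periodic (λ i → potential (evenRuns i) (parity i) (oddStrip i))) step)
           (*-comm n 2))
    where
    step : ∀ x → weightAt evenRuns x + potentialAt evenRuns x ≡ 2 + potentialAt evenRuns (suc x)
    step x = trans (local-exact (startsStrip f (idx x)) (runStep x) (runStep (suc x)))
                   (cong (2 +_) (sym (potentialAt-next evenRuns x)))

difference-mono : ∀ a b a′ b′ → a + b′ ≤ a′ + b → ⁺ a -ℤ ⁺ b ≤ℤ ⁺ a′ -ℤ ⁺ b′
difference-mono a b a′ b′ h = begin
  ⁺ a -ℤ ⁺ b            ≡⟨ ℤ.m-n≡m⊖n a b ⟩
  a ⊖ b                 ≡⟨ ℤ.+-cancelˡ-⊖ b′ a b ⟨
  (b′ + a) ⊖ (b′ + b)   ≡⟨ cong₂ _⊖_ (+-comm b′ a) (+-comm b′ b) ⟩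
  (a + b′) ⊖ (b + b′)   ≤⟨ ℤ.⊖-monoˡ-≤ (b + b′) h ⟩
  (a′ + b) ⊖ (b + b′)   ≡⟨ cong (_⊖ (b + b′)) (+-comm a′ b) ⟩
  (b + a′) ⊖ (b + b′)   ≡⟨ ℤ.+-cancelˡ-⊖ b a′ b′ ⟩
  a′ ⊖ b′               ≡⟨ ℤ.m-n≡m⊖n a′ b′ ⟨
  ⁺ a′ -ℤ ⁺ b′          ∎
  where open ℤ.≤-Reasoning

exchange : ∀ N u a b u′ a′ b′ → 2 * N ≤ 2 * u + a + b → 2 * u′ + a′ + b′ ≡ 2 * N →
  u + a ≤ u′ + a′ → a + b′ ≤ a′ + b
exchange N u a b u′ a′ b′ lower exact smaller = +-cancelˡ-≤ (2 * N) _ _ (begin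
  2 * N + (a + b′)             ≤⟨ +-monoˡ-≤ (a + b′) lower ⟩
  2 * u + a + b + (a + b′)     ≡⟨ regroup u a b b′ ⟩
  2 * (u + a) + (b + b′)       ≤⟨ +-monoˡ-≤ (b + b′) (*-monoʳ-≤ 2 smaller) ⟩
  2 * (u′ + a′) + (b + b′)     ≡⟨ regroup′ u′ a′ b b′ ⟩
  2 * u′ + a′ + b′ + (a′ + b)  ≡⟨ cong (_+ (a′ + b)) exact ⟩
  2 * N + (a′ + b)             ∎)
  where
  open ≤-Reasoning
  regroup : ∀ u a b b′ → 2 * u + a + b + (a + b′) ≡ 2 * (u + a) + (b + b′)
  regroup = solve 4 (λ u a b b′ → con 2 :* u :+ a :+ b :+ (a :+ b′) := con 2 :* (u :+ a) :+ (b :+ b′)) refl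
  regroup′ : ∀ u a b b′ → 2 * (u + a) + (b + b′) ≡ 2 * u + a + b′ + (a + b)
  regroup′ = solve 4 (λ u a b b′ → con 2 :* (u :+ a) :+ (b :+ b′) := con 2 :* u :+ a :+ b′ :+ (a :+ b)) refl

-- A trivial cover has size u + N with 2u ≥ N; a cover of size u′ + a′ with
-- 2u′ + a′ + b′ = 2N and a′ < N is strictly smaller.
trivial-not-smaller : ∀ N u u′ a′ b′ → N ≤ 2 * u → 2 * u′ + a′ + b′ ≡ 2 * N → a′ < N →
  u + N ≤ u′ + a′ → ⊥
trivial-not-smaller N u u′ a′ b′ half exact a′<N smaller = <⇒≱ (+-monoʳ-< (2 * N) a′<N) (begin
  2 * N + N            ≤⟨ +-monoʳ-≤ (2 * N) half ⟩
  2 * N + 2 * u        ≡⟨ regroup N u ⟩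
  2 * (u + N)          ≤⟨ *-monoʳ-≤ 2 smaller ⟩
  2 * (u′ + a′)        ≡⟨ regroup′ u′ a′ ⟩
  2 * u′ + a′ + a′     ≤⟨ +-monoˡ-≤ a′ (≤-trans (m≤m+n (2 * u′ + a′) b′) (≤-reflexive exact)) ⟩
  2 * N + a′           ∎)
  where
  open ≤-Reasoning
  regroup : ∀ N u → 2 * N + 2 * u ≡ 2 * (u + N)
  regroup = solve 2 (λ N u → con 2 :* N :+ con 2 :* u := con 2 :* (u :+ N)) refl
  regroup′ : ∀ u a → 2 * (u + a) ≡ 2 * u + a + a
  regroup′ = solve 2 (λ u a → con 2 :* (u :+ a) := con 2 :* u :+ a :+ a) refl

module Covers (m : ℕ) where
  open Cyclic m

  from-idx : (P : Fin n → Set) → (∀ x → P (idx x)) → ∀ i → P i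
  from-idx P h i = subst P (idx-toℕ i) (h (toℕ i))

  cover-cycle : ∀ {k} (c : Cover n) → IsVertexCover n k c → ∀ x → T (inU c (idx x) ∨ inU c (idx (suc x)))
  cover-cycle c vc x = subst (λ i → T (inU c (idx x) ∨ inU c i)) (idx-suc x) (proj₁ (vc (idx x)))

  cover-lower : ∀ {k} (c : Cover n) → IsVertexCover n k c → NonTrivial c →
    2 * n ≤ 2 * count (inU c) + aC c + bC c
  cover-lower c vc (j , fj) =
    Strips.lower-bound m (inV c) j fj (inU c) (cover-cycle c vc) (λ i → proj₁ (proj₂ (vc i)))

  cycle-lower : ∀ {k} (c : Cover n) → IsVertexCover n k c → n ≤ 2 * count (inU c)
  cycle-lower c vc = subst₂ _≤_ (*-identityʳ n) (trans (sumFrom-scale 2 [u] 0 n) (cong (2 *_) (sym (count-sumFrom (inU c)))))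
    (potential-lower 1 (λ x → 2 * [u] x) (λ x → [ not (inU c (idx x)) ]) (periodic (λ i → [ not (inU c i) ]))
      (λ x → cycle-step (inU c (idx x)) (inU c (idx (suc x))) (cover-cycle c vc x)))
    where
    [u] : ℕ → ℕ
    [u] x = [ inU c (idx x) ]

  complete : (f : Fin n → Bool) (j : Fin n) → f j ≡ false → Cover n
  complete f j fj = mkCover (Strips.evenRuns m f j fj) f

  complete-isCover : ∀ k f j fj → (∀ i → T (f i ∨ f (i ⊕ k))) → IsVertexCover n k (complete f j fj)
  complete-isCover k f j fj spokesV i = cycle i , from-idx (λ i → T (g i ∨ f i)) evenRuns-spokes i , spokesV i
    where
    open Strips m f j fj using (evenRuns-cycle; evenRuns-spokes) renaming (evenRuns to g)
    cycle : ∀ i → T (g i ∨ g (i ⊕ 1))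
    cycle = from-idx (λ i → T (g i ∨ g (i ⊕ 1)))
      (λ x → subst (λ i → T (g (idx x) ∨ g i)) (sym (idx-suc x)) (evenRuns-cycle x))

  complete-exact : ∀ f j fj → let c = complete f j fj in 2 * count (inU c) + aC c + bC c ≡ 2 * n
  complete-exact f j fj = Strips.evenRuns-exact m f j fj

  allBut0 : Fin n → Bool
  allBut0 zero    = false
  allBut0 (suc _) = true

  allBut0-spokes : ∀ k → 1 ≤ k → k < n → ∀ i → T (allBut0 i ∨ allBut0 (i ⊕ k))
  allBut0-spokes k 1≤k k<n zero = subst (λ b → T (false ∨ b)) (sym (nonzero (idx k) toℕ-idx)) tt
    where
    toℕ-idx : toℕ (idx k) ≡ k
    toℕ-idx = trans (toℕ-fromℕ< (m%n<n k n)) (m<n⇒m%n≡m k<n)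
    nonzero : ∀ i → toℕ i ≡ k → allBut0 i ≡ true
    nonzero zero    0≡k = ⊥-elim (1+n≰n (subst (1 ≤_) (sym 0≡k) 1≤k))
    nonzero (suc i) _   = refl
  allBut0-spokes k 1≤k k<n (suc i) = tt

  allBut0-size : count allBut0 < n
  allBut0-size = s≤s (subst (_≤ m) (sym (count-sumFrom allBut0))
    (≤-trans (sumFrom-mono {H = λ _ → 1} [≤1] 1 m) (≤-reflexive (trans (sumFrom-const 1 1 m) (*-identityʳ m)))))
    where
    [≤1] : ∀ x → [ allBut0 (idx x) ] ≤ 1
    [≤1] x with allBut0 (idx x)
    ... | true  = ≤-refl
    ... | false = z≤n

  -- Minimum vertex covers are non-trivial: a cover containing all of V is
  -- beaten by the completion of {v_1, …, v_{n-1}}.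
  minimum-nonTrivial : ∀ k → 1 ≤ k → k < n → (c : Cover n) → IsMinimumVertexCover n k c → NonTrivial c
  minimum-nonTrivial k 1≤k k<n c (vc , minimal) with all? (λ i → inV c i ≟ᵇ true)
  ... | no notAll = let (i , i∉c) = ¬∀⟶∃¬ n _ (λ i → inV c i ≟ᵇ true) notAll in i , ¬-not i∉c
  ... | yes allV = ⊥-elim (trivial-not-smaller n (count (inU c)) (count (inU c₀)) (aC c₀) (bC c₀)
                            (cycle-lower c vc) (complete-exact allBut0 zero refl) allBut0-size smaller)
    where
    c₀ : Cover n
    c₀ = complete allBut0 zero refl
    fullV : aC c ≡ n
    fullV = trans (count-sumFrom (inV c))
      (trans (sumFrom-cong (λ x → cong [_] (allV (idx x))) 0 n) (trans (sumFrom-const 1 0 n) (*-identityʳ n)))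
    smaller : count (inU c) + n ≤ count (inU c₀) + aC c₀
    smaller = subst (λ a → count (inU c) + a ≤ count (inU c₀) + aC c₀) fullV
      (minimal c₀ (complete-isCover k allBut0 zero refl (allBut0-spokes k 1≤k k<n)))

-- For any non-trivial cover c′, complete the V-part of c′ to c″;
-- then 2|c ∩ U| + a + b ≥ 2n = 2|c″ ∩ U| + a″ + b″ and |c| ≤ |c″| give
-- a(c) - b(c) ≤ a(c″) - b(c″) = a(c′) - b(c′).
theorem3 : (n k : ℕ) → 1 ≤ k → 2 * k < n →
    (c : Cover n) → IsMinimumVertexCover n k c → AttainsD n k c
theorem3 zero    k 1≤k () c minimum
theorem3 (suc m) k 1≤k 2k<n c (vc , minimal) = vc , nonTrivial , optimal
  where
  open Cyclic m using (n)
  open Covers m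
  k<n : k < n
  k<n = ≤-<-trans (m≤m+n k (k + 0)) 2k<n
  nonTrivial : NonTrivial c
  nonTrivial = minimum-nonTrivial k 1≤k k<n c (vc , minimal)
  optimal : ∀ c′ → IsVertexCover n k c′ → NonTrivial c′ → abC c ≤ℤ abC c′
  optimal c′ vc′ (j′ , j′∉c′) =
    difference-mono (aC c) (bC c) (aC c″) (bC c″)
      (exchange n (count (inU c)) (aC c) (bC c) (count (inU c″)) (aC c″) (bC c″)
        (cover-lower c vc nonTrivial) (complete-exact (inV c′) j′ j′∉c′) (minimal c″ vc″))
    where
    c″ : Cover n
    c″ = complete (inV c′) j′ j′∉c′
    vc″ : IsVertexCover n k c″
    vc″ = complete-isCover k (inV c′) j′ j′∉c′ (λ i → proj₂ (proj₂ (vc′ i)))
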